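{- For each integer $a$, the language $L_a = \{ (n)_2 : n \geq 0,\ s(n) = a \}$ over the alphabet $\{0,1\}$ is context-free but not regular.
   Context: The infinity series $(s(n))_{n \geq 0}$ is the integer sequence defined by $s(0)=0$, $s(2n) = -s(n)$ for $n \geq 1$, and $s(2n+1) = s(n)+1$ for $n \geq 0$. For $n \geq 0$, $(n)_2$ denotes the binary representation of $n$ without leading zeros (most significant digit first), with $(0)_2$ the empty string. -}

module Defs where

open import Data.Nat using (ℕ; zero; suc)
open import Data.Nat.DivMod using (_/_; _%_)
open import Data.Integer using (ℤ; -_; _+_; +_)
open import Data.Fin using (Fin)
open import Data.List using (List; []; _∷_; _++_; [_])
open import Data.List.Membership.Propositional using (_∈_)
open import Data.Product using (_×_; _,_; Σ; ∃)
open import Data.Sum using (_⊎_; inj₁; inj₂)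
open import Data.Bool using (Bool; true; false)
open import Relation.Binary.PropositionalEquality using (_≡_)
open import Function.Bundles using (_⇔_)

-- The infinity series s.
-- Defined with fuel: sAux f n computes s(n) whenever f ≥ n
-- (each recursive call halves n).  s(0)=0, s(2m) = -s(m), s(2m+1) = s(m)+1.

sAux : ℕ → ℕ → ℤ
sAux zero    _       = + 0
sAux (suc f) zero    = + 0
sAux (suc f) (suc k) with (suc k) % 2
... | zero  = - sAux f (suc k / 2)
... | suc _ = sAux f (suc k / 2) + + 1

s : ℕ → ℤ
s n = sAux n n

Bit : Set
Bit = Fin 2

Word : Set → Set
Word A = List A

-- (n)₂ : binary representation, most significant digit first,
-- no leading zeros, (0)₂ = [].  Fuel as above.
binAux : ℕ → ℕ → Word Bit
binAux zero    _       = []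
binAux (suc f) zero    = []
binAux (suc f) (suc k) with (suc k) % 2
... | zero  = binAux f (suc k / 2) ++ [ Fin.zero ]
... | suc _ = binAux f (suc k / 2) ++ [ Fin.suc Fin.zero ]

bin : ℕ → Word Bit
bin n = binAux n n

Language : Set → Set₁
Language A = Word A → Set

L : ℤ → Language Bit
L a w = ∃ λ n → bin n ≡ w × s n ≡ a

record DFA (A : Set) : Set where
  field
    states : ℕ
    start  : Fin states
    δ      : Fin states → A → Fin states
    final  : Fin states → Bool

runDFA : {A : Set} (M : DFA A) → Fin (DFA.states M) → Word A → Fin (DFA.states M)
runDFA M q []      = q
runDFA M q (c ∷ w) = runDFA M (DFA.δ M q c) w

Accepts : {A : Set} → DFA A → Word A → Set
Accepts M w = DFA.final M (runDFA M (DFA.start M) w) ≡ true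

IsRegular : {A : Set} → Language A → Set
IsRegular {A} Lang = Σ (DFA A) λ M → ∀ w → Lang w ⇔ Accepts M w

record CFG (A : Set) : Set where
  field
    nonterminals : ℕ
    startSym     : Fin nonterminals
    rules        : List (Fin nonterminals × List (Fin nonterminals ⊎ A))

data Derives {A : Set} (G : CFG A) :
       List (Fin (CFG.nonterminals G) ⊎ A) → Word A → Set where
  d-nil  : Derives G [] []
  d-term : ∀ {c α w} → Derives G α w → Derives G (inj₂ c ∷ α) (c ∷ w)
  d-nt   : ∀ {N β α u v} → (N , β) ∈ CFG.rules G →
           Derives G β u → Derives G α v →
           Derives G (inj₁ N ∷ α) (u ++ v)

Generates : {A : Set} → CFG A → Word A → Set
Generates G w = Derives G [ inj₁ (CFG.startSym G) ] w

IsContextFree : {A : Set} → Language A → Set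
IsContextFree {A} Lang = Σ (CFG A) λ G → ∀ w → Lang w ⇔ Generates G w

-- Reading (n)₂ from its leading digit, s(n) is computed by a machine on ℤ that negates
-- its value on 0 and adds 1 on 1; so L a consists of the words that are empty or start
-- with 1 and drive this machine from 0 to a.  A grammar simulates the machine on its stack:
-- a state x with ∣x∣ ≤ |a| is one nonterminal, and a larger state is down σ (σ the sign
-- of x) followed by ∣x∣ - 1 - |a| copies of down - and the nonterminal of -|a|, where down σ
-- stands for the words taking σ(h+1) to -h for every h.  Since the machine acts on large
-- magnitudes uniformly, reading a digit only rewrites the top symbol, by one of four
-- productions independent of ∣x∣.  Non-regularity: 1ⁱ⁺¹0 · 1ʲ⁺¹w, with w a word of value a,
-- lies in L a exactly when i = j, because the machine is injective in its starting value.

module Submission where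

open import Defs
open import Data.Fin as Fin using (Fin; toℕ)
open import Data.Fin.Properties using (toℕ<n; toℕ-fromℕ<; toℕ-injective; pigeonhole; <⇒≢)
open import Data.Integer as ℤ using (ℤ; +_; -[1+_]; -_; _+_; ∣_∣; _◃_)
import Data.Integer.Properties as ℤ
open import Algebra.Properties.AbelianGroup ℤ.+-0-abelianGroup using (∙-cancelʳ)
open import Data.List
  using (List; []; _∷_; _++_; [_]; foldl; replicate; map; upTo; cartesianProductWith)
open import Data.List.Properties using (foldl-++; ++-identityʳ; ++-assoc)
open import Data.List.Membership.Propositional using (_∈_)
open import Data.List.Membership.Propositional.Properties
  using ( ∈-++⁺ˡ; ∈-++⁺ʳ; ∈-++⁻; ∈-map⁺; ∈-map⁻; ∈-upTo⁺; ∈-upTo⁻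
        ; ∈-cartesianProductWith⁺; ∈-cartesianProductWith⁻)
open import Data.List.Relation.Unary.Any using (here; there)
open import Data.Nat as ℕ using (ℕ; zero; suc; _≤_; _<_; z≤n; s≤s; _≤?_)
import Data.Nat.Properties as ℕ
open import Data.Nat.DivMod
  using ( _/_; _%_; _mod_; m/n<m; m≡m%n+[m/n]*n; [m+kn]%n≡m%n; m<n⇒m%n≡m; m<n⇒m/n≡0
        ; m*n/n≡m; m*n%n≡0; m%n<n; +-distrib-/)
open import Data.Product using (_×_; _,_; proj₂; ∃; ∃₂)
open import Data.Sign as Sign using (Sign)
open import Data.Sum using (_⊎_; inj₁; inj₂)
open import Function using (_∘_)
open import Function.Bundles using (_⇔_; mk⇔; Equivalence)
open import Function.Properties.Equivalence using () renaming (trans to ⇔-trans)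
open import Relation.Binary.PropositionalEquality
  using (_≡_; _≢_; refl; sym; trans; cong; cong₂; subst; module ≡-Reasoning)
open import Relation.Nullary using (¬_; yes; no; contradiction)

run-++ : ∀ {A} (M : DFA A) q x y → runDFA M q (x ++ y) ≡ runDFA M (runDFA M q x) y
run-++ M q []      y = refl
run-++ M q (c ∷ x) y = run-++ M (DFA.δ M q c) x y

-- A DFA with n states sends two of the prefixes u 0, …, u n to the same state.
¬regular-by-fooling-set : ∀ {A} {Lang : Language A} (u v : ℕ → Word A) →
  (∀ i → Lang (u i ++ v i)) → (∀ {i j} → Lang (u i ++ v j) → i ≡ j) → ¬ IsRegular Lang
¬regular-by-fooling-set u v accept reject (M , decides)
  with pigeonhole (ℕ.n<1+n (DFA.states M)) (λ i → runDFA M (DFA.start M) (u (toℕ i)))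
... | i , j , i<j , same = <⇒≢ i<j (toℕ-injective (sym (reject (Equivalence.from (decides _) accepts-ji))))
  where
  open ≡-Reasoning
  q₀ = DFA.start M
  accepts-ji : Accepts M (u (toℕ j) ++ v (toℕ i))
  accepts-ji = trans (cong (DFA.final M) (begin
    runDFA M q₀ (u (toℕ j) ++ v (toℕ i))             ≡⟨ run-++ M q₀ (u (toℕ j)) (v (toℕ i)) ⟩
    runDFA M (runDFA M q₀ (u (toℕ j))) (v (toℕ i))   ≡⟨ cong (λ q → runDFA M q (v (toℕ i))) (sym same) ⟩
    runDFA M (runDFA M q₀ (u (toℕ i))) (v (toℕ i))   ≡⟨ sym (run-++ M q₀ (u (toℕ i)) (v (toℕ i))) ⟩
    runDFA M q₀ (u (toℕ i) ++ v (toℕ i))             ∎))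
    (Equivalence.to (decides _) (accept (toℕ i)))

SatSymbol : ∀ {A n} → (Fin n → Language A) → Fin n ⊎ A → Language A
SatSymbol I (inj₁ N) = I N
SatSymbol I (inj₂ c) w = w ≡ [ c ]

Sat : ∀ {A n} → (Fin n → Language A) → List (Fin n ⊎ A) → Language A
Sat I []      w = w ≡ []
Sat I (X ∷ α) w = ∃₂ λ u v → w ≡ u ++ v × SatSymbol I X u × Sat I α v

Sat-[-]⁻ : ∀ {A n} (I : Fin n → Language A) X {w} → Sat I [ X ] w → SatSymbol I X w
Sat-[-]⁻ I X (u , _ , refl , satX , refl) = subst (SatSymbol I X) (sym (++-identityʳ u)) satX

module _ {A : Set} (G : CFG A) where
  open CFG G

  derives-split : ∀ β {α w} → Derives G (β ++ α) w →
                  ∃₂ λ u v → w ≡ u ++ v × Derives G β u × Derives G α v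
  derives-split []           d          = [] , _ , refl , d-nil , d
  derives-split (inj₂ c ∷ β) (d-term d) with derives-split β d
  ... | u , v , refl , dβ , dα = c ∷ u , v , refl , d-term dβ , dα
  derives-split (inj₁ N ∷ β) (d-nt {u = u₀} r dN d) with derives-split β d
  ... | u , v , refl , dβ , dα = u₀ ++ u , v , sym (++-assoc u₀ u v) , d-nt r dN dβ , dα

  derives-rule : ∀ {N β α w} → (N , β) ∈ rules → Derives G (β ++ α) w → Derives G (inj₁ N ∷ α) w
  derives-rule {β = β} r d with derives-split β d
  ... | u , v , refl , dβ , dα = d-nt r dβ dα

  derives-rule₁ : ∀ {N β w} → (N , β) ∈ rules → Derives G β w → Derives G [ inj₁ N ] w
  derives-rule₁ {w = w} r d = subst (Derives G _) (++-identityʳ w) (d-nt r d d-nil)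

  derives-sound : (I : Fin nonterminals → Language A) →
                  (∀ {N β u} → (N , β) ∈ rules → Sat I β u → I N u) →
                  ∀ {β w} → Derives G β w → Sat I β w
  derives-sound I sound d-nil                                 = refl
  derives-sound I sound (d-term {c = c} {w = w} d)            = [ c ] , w , refl , refl , derives-sound I sound d
  derives-sound I sound (d-nt {u = u} {v = v} r dN d) =
    u , v , refl , sound r (derives-sound I sound dN) , derives-sound I sound d

-- s(n) as the value of (n)₂

pattern b0 = Fin.zero
pattern b1 = Fin.suc Fin.zero

step : ℤ → Bit → ℤ
step x b0 = - x
step x b1 = x + + 1

valFrom : ℤ → Word Bit → ℤ
valFrom = foldl step

val : Word Bit → ℤ
val = valFrom (+ 0)

valFrom-++ : ∀ x u v → valFrom x (u ++ v) ≡ valFrom (valFrom x u) v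
valFrom-++ = foldl-++ step

valFrom-injective : ∀ {x y} w → valFrom x w ≡ valFrom y w → x ≡ y
valFrom-injective []        e = e
valFrom-injective (b0 ∷ w) e = ℤ.neg-injective (valFrom-injective w e)
valFrom-injective (b1 ∷ w) e = ∙-cancelʳ (+ 1) _ _ (valFrom-injective w e)

ones : ℕ → Word Bit
ones n = replicate n b1

valFrom-ones : ∀ x n → valFrom x (ones n) ≡ x + + n
valFrom-ones x zero    = sym (ℤ.+-identityʳ x)
valFrom-ones x (suc n) = trans (valFrom-ones (x + + 1) n) (ℤ.+-assoc x (+ 1) (+ n))

data Canonical : Word Bit → Set where
  empty   : Canonical []
  leading : ∀ u → Canonical (b1 ∷ u)

+n+1≡+[1+n] : ∀ m → + m + + 1 ≡ + suc m
+n+1≡+[1+n] m = cong +_ (ℕ.+-comm m 1)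

-[1+n]+1≡-n : ∀ m → -[1+ m ] + + 1 ≡ - + m
-[1+n]+1≡-n m = trans (ℤ.+-comm -[1+ m ] (+ 1)) (ℤ.1-[1+n]≡-n m)

digit : ℕ → Bit
digit zero    = b0
digit (suc _) = b1

digit-toℕ : ∀ c → digit (toℕ c) ≡ c
digit-toℕ b0 = refl
digit-toℕ b1 = refl

binAux-suc : ∀ f k → binAux (suc f) (suc k) ≡ binAux f (suc k / 2) ++ [ digit (suc k % 2) ]
binAux-suc f k with suc k % 2
... | zero  = refl
... | suc _ = refl

sAux-suc : ∀ f k → sAux (suc f) (suc k) ≡ step (sAux f (suc k / 2)) (digit (suc k % 2))
sAux-suc f k with suc k % 2
... | zero  = refl
... | suc _ = refl

half-suc≤ : ∀ k → suc k / 2 ≤ k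
half-suc≤ k = ℕ.≤-pred (m/n<m (suc k) 2 (s≤s (s≤s z≤n)))

sAux≡val∘binAux : ∀ f n → n ≤ f → sAux f n ≡ val (binAux f n)
sAux≡val∘binAux zero    zero    _         = refl
sAux≡val∘binAux (suc f) zero    _         = refl
sAux≡val∘binAux (suc f) (suc k) (s≤s k≤f) = begin
  sAux (suc f) (suc k)          ≡⟨ sAux-suc f k ⟩
  step (sAux f m) d             ≡⟨ cong (λ x → step x d) (sAux≡val∘binAux f m m≤f) ⟩
  step (val (binAux f m)) d     ≡⟨ sym (valFrom-++ (+ 0) (binAux f m) [ d ]) ⟩
  val (binAux f m ++ [ d ])     ≡⟨ cong val (sym (binAux-suc f k)) ⟩
  val (binAux (suc f) (suc k))  ∎
  where
  open ≡-Reasoning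
  m = suc k / 2
  d = digit (suc k % 2)
  m≤f = ℕ.≤-trans (half-suc≤ k) k≤f

s≡val∘bin : ∀ n → s n ≡ val (bin n)
s≡val∘bin n = sAux≡val∘binAux n n ℕ.≤-refl

BinShape : ℕ → Word Bit → Set
BinShape zero    w = w ≡ []
BinShape (suc _) w = ∃ λ u → w ≡ b1 ∷ u

even-half-nonzero : ∀ k → suc k % 2 ≡ 0 → suc k / 2 ≢ 0
even-half-nonzero k even half≡0 =
  ℕ.1+n≢0 (trans (m≡m%n+[m/n]*n (suc k) 2) (cong₂ (λ r q → r ℕ.+ q ℕ.* 2) even half≡0))

binAux-shape : ∀ f n → n ≤ f → BinShape n (binAux f n)
binAux-shape zero    zero    _         = refl
binAux-shape (suc f) zero    _         = refl
binAux-shape (suc f) (suc k) (s≤s k≤f) rewrite binAux-suc f k =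
  append (suc k % 2) (suc k / 2)
    (binAux-shape f (suc k / 2) (ℕ.≤-trans (half-suc≤ k) k≤f)) (even-half-nonzero k)
  where
  append : ∀ r m {w} → BinShape m w → (r ≡ 0 → m ≢ 0) → ∃ λ u → w ++ [ digit r ] ≡ b1 ∷ u
  append zero    zero    _          nonzero = contradiction refl (nonzero refl)
  append (suc _) zero    refl       _       = [] , refl
  append r       (suc _) (u , refl) _       = u ++ [ digit r ] , refl

bin-canonical : ∀ n → Canonical (bin n)
bin-canonical n = canonical n (binAux-shape n n ℕ.≤-refl)
  where
  canonical : ∀ n {w} → BinShape n w → Canonical w
  canonical zero    refl       = empty
  canonical (suc _) (u , refl) = leading u

binAux-fuel : ∀ f g n → n ≤ f → n ≤ g → binAux f n ≡ binAux g n
binAux-fuel zero    zero    zero    _         _         = refl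
binAux-fuel zero    (suc g) zero    _         _         = refl
binAux-fuel (suc f) zero    zero    _         _         = refl
binAux-fuel (suc f) (suc g) zero    _         _         = refl
binAux-fuel (suc f) (suc g) (suc k) (s≤s k≤f) (s≤s k≤g) rewrite binAux-suc f k | binAux-suc g k =
  cong (_++ [ digit (suc k % 2) ])
    (binAux-fuel f g (suc k / 2) (ℕ.≤-trans (half-suc≤ k) k≤f) (ℕ.≤-trans (half-suc≤ k) k≤g))

bin-suc : ∀ k → bin (suc k) ≡ bin (suc k / 2) ++ [ digit (suc k % 2) ]
bin-suc k = trans (binAux-suc k k)
  (cong (_++ [ digit (suc k % 2) ]) (binAux-fuel k (suc k / 2) (suc k / 2) (half-suc≤ k) ℕ.≤-refl))

[c+m*2]/2≡m : ∀ (c : Bit) m → (toℕ c ℕ.+ m ℕ.* 2) / 2 ≡ m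
[c+m*2]/2≡m c m = begin
  (toℕ c ℕ.+ m ℕ.* 2) / 2    ≡⟨ +-distrib-/ (toℕ c) (m ℕ.* 2) no-carry ⟩
  toℕ c / 2 ℕ.+ m ℕ.* 2 / 2  ≡⟨ cong₂ ℕ._+_ (m<n⇒m/n≡0 (toℕ<n c)) (m*n/n≡m m 2) ⟩
  m                          ∎
  where
  open ≡-Reasoning
  no-carry : toℕ c % 2 ℕ.+ m ℕ.* 2 % 2 < 2
  no-carry = subst (λ r → toℕ c % 2 ℕ.+ r < 2) (sym (m*n%n≡0 m 2))
               (subst (_< 2) (sym (ℕ.+-identityʳ (toℕ c % 2))) (m%n<n (toℕ c) 2))

[c+m*2]%2≡c : ∀ (c : Bit) m → (toℕ c ℕ.+ m ℕ.* 2) % 2 ≡ toℕ c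
[c+m*2]%2≡c c m = trans ([m+kn]%n≡m%n (toℕ c) m 2) (m<n⇒m%n≡m (toℕ<n c))

bin-snoc : ∀ n c → ∃ λ m → bin (suc m) ≡ bin (suc n) ++ [ c ]
bin-snoc n c = m , (begin
  bin (suc m)                               ≡⟨ bin-suc m ⟩
  bin (suc m / 2) ++ [ digit (suc m % 2) ]  ≡⟨ cong₂ (λ q r → bin q ++ [ digit r ])
                                                (trans (cong (_/ 2) suc-m) ([c+m*2]/2≡m c (suc n)))
                                                (trans (cong (_% 2) suc-m) ([c+m*2]%2≡c c (suc n))) ⟩
  bin (suc n) ++ [ digit (toℕ c) ]          ≡⟨ cong (λ d → bin (suc n) ++ [ d ]) (digit-toℕ c) ⟩
  bin (suc n) ++ [ c ]                      ∎)
  where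
  open ≡-Reasoning
  m = toℕ c ℕ.+ suc (n ℕ.* 2)
  suc-m : suc m ≡ toℕ c ℕ.+ suc n ℕ.* 2
  suc-m = sym (ℕ.+-suc (toℕ c) (suc (n ℕ.* 2)))

bin-extend : ∀ u {n w} → bin (suc n) ≡ w → ∃ λ m → bin (suc m) ≡ w ++ u
bin-extend []      {n}     e = n , trans e (sym (++-identityʳ _))
bin-extend (c ∷ u) {n} {w} e with bin-snoc n c
... | m , e′ with bin-extend u {m} (trans e′ (cong (_++ [ c ]) e))
... | m′ , e″ = m′ , trans e″ (++-assoc w [ c ] u)

bin-onto : ∀ {w} → Canonical w → ∃ λ n → bin n ≡ w
bin-onto empty       = 0 , refl
bin-onto (leading u) with bin-extend u {0} refl
... | m , e = suc m , e

L⇔canonical×val : ∀ a w → L a w ⇔ (Canonical w × val w ≡ a)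
L⇔canonical×val a w = mk⇔ to from
  where
  to : L a w → Canonical w × val w ≡ a
  to (n , refl , sn≡a) = bin-canonical n , trans (sym (s≡val∘bin n)) sn≡a
  from : Canonical w × val w ≡ a → L a w
  from (can , val≡a) with bin-onto can
  ... | n , refl = n , refl , trans (s≡val∘bin n) val≡a

-- A grammar for L a

ℤ-code : ℤ → ℕ
ℤ-code (+ n)    = n ℕ.+ n
ℤ-code -[1+ n ] = suc (n ℕ.+ n)

ℤ-next : ℤ → ℤ
ℤ-next (+ n)    = -[1+ n ]
ℤ-next -[1+ n ] = + suc n

ℤ-decode : ℕ → ℤ
ℤ-decode zero    = + 0
ℤ-decode (suc m) = ℤ-next (ℤ-decode m)

ℤ-decode-n+n : ∀ n → ℤ-decode (n ℕ.+ n) ≡ + n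
ℤ-decode-n+n zero    = refl
ℤ-decode-n+n (suc n) rewrite ℕ.+-suc n n = cong (ℤ-next ∘ ℤ-next) (ℤ-decode-n+n n)

ℤ-decode-code : ∀ x → ℤ-decode (ℤ-code x) ≡ x
ℤ-decode-code (+ n)    = ℤ-decode-n+n n
ℤ-decode-code -[1+ n ] = cong ℤ-next (ℤ-decode-n+n n)

ℤ-code≤∣x∣+∣x∣ : ∀ x → ℤ-code x ≤ ∣ x ∣ ℕ.+ ∣ x ∣
ℤ-code≤∣x∣+∣x∣ (+ n)    = ℕ.≤-refl
ℤ-code≤∣x∣+∣x∣ -[1+ n ] = s≤s (ℕ.+-monoʳ-≤ n (ℕ.n≤1+n n))

data Sym : Set where
  start : Sym
  down  : Sign → Sym
  from  : ℤ → Sym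

code : Sym → ℕ
code start         = 0
code (down Sign.+) = 1
code (down Sign.-) = 2
code (from x)      = 3 ℕ.+ ℤ-code x

decode : ℕ → Sym
decode 0                   = start
decode 1                   = down Sign.+
decode 2                   = down Sign.-
decode (suc (suc (suc m))) = from (ℤ-decode m)

decode-code : ∀ s → decode (code s) ≡ s
decode-code start         = refl
decode-code (down Sign.+) = refl
decode-code (down Sign.-) = refl
decode-code (from x)      = cong from (ℤ-decode-code x)

module Grammar (a : ℤ) where

  k : ℕ
  k = ∣ a ∣

  n : ℕ
  n = 4 ℕ.+ (k ℕ.+ k)

  -- Faithful only for codes below n, which covers start, down σ and from x with ∣ x ∣ ≤ k.
  ⌜_⌝ : Sym → Fin n
  ⌜ s ⌝ = code s mod n

  decode-⌜⌝ : ∀ s → code s < n → decode (toℕ ⌜ s ⌝) ≡ s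
  decode-⌜⌝ s p = trans (cong decode (trans (toℕ-fromℕ< _) (m<n⇒m%n≡m p))) (decode-code s)

  code-from< : ∀ {x} → ∣ x ∣ ≤ k → code (from x) < n
  code-from< {x} p = s≤s (s≤s (s≤s (s≤s (ℕ.≤-trans (ℤ-code≤∣x∣+∣x∣ x) (ℕ.+-mono-≤ p p)))))

  ⟦_⟧ : Sym → Language Bit
  ⟦ start ⟧  w = Canonical w × val w ≡ a
  ⟦ down σ ⟧ w = ∀ h → valFrom (σ ◃ suc h) w ≡ - + h
  ⟦ from x ⟧ w = valFrom x w ≡ a

  I : Fin n → Language Bit
  I N = ⟦ decode (toℕ N) ⟧

  I-from : ∀ {x} → ∣ x ∣ ≤ k → I ⌜ from x ⌝ ≡ ⟦ from x ⟧
  I-from {x} p = cong ⟦_⟧ (decode-⌜⌝ (from x) (code-from< {x} p))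

  I-down : ∀ σ → I ⌜ down σ ⌝ ≡ ⟦ down σ ⟧
  I-down Sign.+ = refl
  I-down Sign.- = refl

  Form : Set
  Form = List (Fin n ⊎ Bit)

  ⟪_⟫ : Sym → Fin n ⊎ Bit
  ⟪ s ⟫ = inj₁ ⌜ s ⌝

  -- form x derives the words leading from x to a: the nonterminal from x while ∣ x ∣ ≤ k,
  -- otherwise a descent to - (∣ x ∣ - 1) followed by down - steps to - k.
  formSuc : Sign → ℕ → Form → Form
  formSuc σ h α with suc h ≤? k
  ... | yes _ = [ ⟪ from (σ ◃ suc h) ⟫ ]
  ... | no  _ = ⟪ down σ ⟫ ∷ α

  chain : ℕ → Form
  chain zero    = [ ⟪ from (+ 0) ⟫ ]
  chain (suc h) = formSuc Sign.- h (chain h)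

  form : ℤ → Form
  form (+ zero)  = chain 0
  form (+ suc h) = formSuc Sign.+ h (chain h)
  form -[1+ h ]  = chain (suc h)

  form-neg : ∀ h → form (- + h) ≡ chain h
  form-neg zero    = refl
  form-neg (suc h) = refl

  formSuc-small : ∀ σ {h α} → suc h ≤ k → formSuc σ h α ≡ [ ⟪ from (σ ◃ suc h) ⟫ ]
  formSuc-small σ {h} p with suc h ≤? k
  ... | yes _ = refl
  ... | no ¬p = contradiction p ¬p

  formSuc-large : ∀ σ {h α} → k ≤ h → formSuc σ h α ≡ ⟪ down σ ⟫ ∷ α
  formSuc-large σ {h} p with suc h ≤? k
  ... | yes q = contradiction q (ℕ.<⇒≱ (s≤s p))
  ... | no  _ = refl

  form-small : ∀ {x} → ∣ x ∣ ≤ k → form x ≡ [ ⟪ from x ⟫ ]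
  form-small {+ zero}   _ = refl
  form-small {+ suc h}  p = formSuc-small Sign.+ p
  form-small { -[1+ h ]} p = formSuc-small Sign.- p

  form-large : ∀ σ {h} → k ≤ h → form (σ ◃ suc h) ≡ ⟪ down σ ⟫ ∷ chain h
  form-large Sign.+ p = formSuc-large Sign.+ p
  form-large Sign.- p = formSuc-large Sign.- p

  downRhs : Sign → Bit → Form
  downRhs Sign.+ b0 = [ ⟪ down Sign.- ⟫ ]
  downRhs Sign.+ b1 = ⟪ down Sign.+ ⟫ ∷ ⟪ down Sign.- ⟫ ∷ []
  downRhs Sign.- b0 = [ ⟪ down Sign.+ ⟫ ]
  downRhs Sign.- b1 = []

  form-step-large : ∀ σ c {h} → k ≤ h → form (step (σ ◃ suc h) c) ≡ downRhs σ c ++ chain h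
  form-step-large Sign.+ b0     p = form-large Sign.- p
  form-step-large Sign.+ b1 {h} p = begin
    form (+ suc h + + 1)                        ≡⟨ cong form (+n+1≡+[1+n] (suc h)) ⟩
    form (+ suc (suc h))                        ≡⟨ form-large Sign.+ (ℕ.m≤n⇒m≤1+n p) ⟩
    ⟪ down Sign.+ ⟫ ∷ chain (suc h)             ≡⟨ cong (⟪ down Sign.+ ⟫ ∷_) (form-large Sign.- p) ⟩
    ⟪ down Sign.+ ⟫ ∷ ⟪ down Sign.- ⟫ ∷ chain h  ∎
    where open ≡-Reasoning
  form-step-large Sign.- b0     p = form-large Sign.+ p
  form-step-large Sign.- b1 {h} p = trans (cong form (-[1+n]+1≡-n h)) (form-neg h)

  Rule : Set
  Rule = Fin n × Form

  downRule : Sign → Bit → Rule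
  downRule σ c = ⌜ down σ ⌝ , inj₂ c ∷ downRhs σ c

  fromRule : ℤ → Bit → Rule
  fromRule x c = ⌜ from x ⌝ , inj₂ c ∷ form (step x c)

  signs : List Sign
  signs = Sign.+ ∷ Sign.- ∷ []

  bits : List Bit
  bits = b0 ∷ b1 ∷ []

  small : List ℤ
  small = map +_ (upTo (suc k)) ++ map -[1+_] (upTo k)

  emptyRules : ℤ → List Rule
  emptyRules (+ zero)  = [ ⌜ start ⌝ , [] ]
  emptyRules (+ suc _) = []
  emptyRules -[1+ _ ]  = []

  downRules fromRules : List Rule
  downRules = cartesianProductWith downRule signs bits
  fromRules = cartesianProductWith fromRule small bits

  startRule acceptRule : Rule
  startRule  = ⌜ start ⌝ , inj₂ b1 ∷ form (+ 1)
  acceptRule = ⌜ from a ⌝ , []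

  rules : List Rule
  rules = startRule ∷ acceptRule ∷ downRules ++ fromRules ++ emptyRules a

  grammar : CFG Bit
  grammar = record { nonterminals = n ; startSym = ⌜ start ⌝ ; rules = rules }

  ∈-small : ∀ {x} → ∣ x ∣ ≤ k → x ∈ small
  ∈-small {+ m}      p = ∈-++⁺ˡ (∈-map⁺ +_ (∈-upTo⁺ (s≤s p)))
  ∈-small { -[1+ m ]} p = ∈-++⁺ʳ (map +_ (upTo (suc k))) (∈-map⁺ -[1+_] (∈-upTo⁺ p))

  small⇒∣∣≤ : ∀ {x} → x ∈ small → ∣ x ∣ ≤ k
  small⇒∣∣≤ x∈ with ∈-++⁻ (map +_ (upTo (suc k))) x∈
  ... | inj₁ x∈⁺ with ∈-map⁻ +_ x∈⁺
  ...   | _ , m∈ , refl = ℕ.≤-pred (∈-upTo⁻ m∈)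
  small⇒∣∣≤ x∈ | inj₂ x∈⁻ with ∈-map⁻ -[1+_] x∈⁻
  ...   | _ , m∈ , refl = ∈-upTo⁻ m∈

  ∈-signs : ∀ σ → σ ∈ signs
  ∈-signs Sign.+ = here refl
  ∈-signs Sign.- = there (here refl)

  ∈-bits : ∀ c → c ∈ bits
  ∈-bits b0 = here refl
  ∈-bits b1 = there (here refl)

  startRule∈ : startRule ∈ rules
  startRule∈ = here refl

  acceptRule∈ : acceptRule ∈ rules
  acceptRule∈ = there (here refl)

  downRule∈ : ∀ σ c → downRule σ c ∈ rules
  downRule∈ σ c = there (there (∈-++⁺ˡ (∈-cartesianProductWith⁺ downRule (∈-signs σ) (∈-bits c))))

  fromRule∈ : ∀ x c → ∣ x ∣ ≤ k → fromRule x c ∈ rules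
  fromRule∈ x c p = there (there (∈-++⁺ʳ downRules
    (∈-++⁺ˡ (∈-cartesianProductWith⁺ fromRule (∈-small {x} p) (∈-bits c)))))

  emptyRule∈ : a ≡ + 0 → (⌜ start ⌝ , []) ∈ rules
  emptyRule∈ a≡0 = there (there (∈-++⁺ʳ downRules (∈-++⁺ʳ fromRules (emptyRule∈emptyRules a a≡0))))
    where
    emptyRule∈emptyRules : ∀ b → b ≡ + 0 → (⌜ start ⌝ , []) ∈ emptyRules b
    emptyRule∈emptyRules _ refl = here refl

  Der : Form → Word Bit → Set
  Der = Derives grammar

  derive-step-large : ∀ σ c {h y} → k ≤ h →
                      Der (form (step (σ ◃ suc h) c)) y → Der (form (σ ◃ suc h)) (c ∷ y)
  derive-step-large σ c p d = subst (λ α → Der α _) (sym (form-large σ p))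
    (derives-rule grammar (downRule∈ σ c) (d-term (subst (λ α → Der α _) (form-step-large σ c p) d)))

  derive-step : ∀ x c {y} → Der (form (step x c)) y → Der (form x) (c ∷ y)
  derive-step x c d with ∣ x ∣ ≤? k
  ... | yes p = subst (λ α → Der α _) (sym (form-small {x} p))
                  (derives-rule₁ grammar (fromRule∈ x c p) (d-term d))
  derive-step (+ zero)  c d | no ¬p = contradiction z≤n ¬p
  derive-step (+ suc h) c d | no ¬p = derive-step-large Sign.+ c (ℕ.≤-pred (ℕ.≰⇒> ¬p)) d
  derive-step -[1+ h ]  c d | no ¬p = derive-step-large Sign.- c (ℕ.≤-pred (ℕ.≰⇒> ¬p)) d

  form-complete : ∀ y x → valFrom x y ≡ a → Der (form x) y
  form-complete []      x refl = subst (λ α → Der α []) (sym (form-small {a} ℕ.≤-refl))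
                                   (d-nt acceptRule∈ d-nil d-nil)
  form-complete (c ∷ y) x e    = derive-step x c (form-complete y (step x c) e)

  from-sound : ∀ {x w} → ∣ x ∣ ≤ k → Sat I [ ⟪ from x ⟫ ] w → valFrom x w ≡ a
  from-sound {x} p s = subst (λ P → P _) (I-from {x} p) (Sat-[-]⁻ I (⟪ from x ⟫) s)

  down-sound : ∀ σ {h v} → (∀ {w} → Sat I (chain h) w → valFrom (- + h) w ≡ a) →
               Sat I (⟪ down σ ⟫ ∷ chain h) v → valFrom (σ ◃ suc h) v ≡ a
  down-sound σ {h} chain-sound (u , w , refl , du , s) = begin
    valFrom (σ ◃ suc h) (u ++ w)         ≡⟨ valFrom-++ (σ ◃ suc h) u w ⟩
    valFrom (valFrom (σ ◃ suc h) u) w    ≡⟨ cong (λ x → valFrom x w) (subst (λ P → P u) (I-down σ) du h) ⟩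
    valFrom (- + h) w                    ≡⟨ chain-sound s ⟩
    a                                    ∎
    where open ≡-Reasoning

  formSuc-sound : ∀ σ h {v} → (∀ {w} → Sat I (chain h) w → valFrom (- + h) w ≡ a) →
                  Sat I (formSuc σ h (chain h)) v → valFrom (σ ◃ suc h) v ≡ a
  formSuc-sound σ h chain-sound s with suc h ≤? k
  ... | yes p = from-sound (subst (_≤ k) (sym (ℤ.abs-◃ σ (suc h))) p) s
  ... | no  _ = down-sound σ chain-sound s

  chain-sound : ∀ h {w} → Sat I (chain h) w → valFrom (- + h) w ≡ a
  chain-sound zero    = from-sound z≤n
  chain-sound (suc h) = formSuc-sound Sign.- h (chain-sound h)

  form-sound : ∀ x {w} → Sat I (form x) w → valFrom x w ≡ a
  form-sound (+ zero)  = chain-sound 0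
  form-sound (+ suc h) = formSuc-sound Sign.+ h (chain-sound h)
  form-sound -[1+ h ]  = chain-sound (suc h)

  downRhs-sound : ∀ σ c {v} → Sat I (downRhs σ c) v → ∀ h → valFrom (step (σ ◃ suc h) c) v ≡ - + h
  downRhs-sound Sign.+ b0 s h = Sat-[-]⁻ I (⟪ down Sign.- ⟫) s h
  downRhs-sound Sign.+ b1 (u , _ , refl , du , (w , _ , refl , dw , refl)) h = begin
    valFrom (+ suc h + + 1) (u ++ w ++ [])       ≡⟨ cong₂ valFrom (+n+1≡+[1+n] (suc h))
                                                                   (cong (u ++_) (++-identityʳ w)) ⟩
    valFrom (+ suc (suc h)) (u ++ w)             ≡⟨ valFrom-++ (+ suc (suc h)) u w ⟩
    valFrom (valFrom (+ suc (suc h)) u) w        ≡⟨ cong (λ x → valFrom x w) (du (suc h)) ⟩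
    valFrom -[1+ h ] w                           ≡⟨ dw h ⟩
    - + h                                        ∎
    where open ≡-Reasoning
  downRhs-sound Sign.- b0 s h    = Sat-[-]⁻ I (⟪ down Sign.+ ⟫) s h
  downRhs-sound Sign.- b1 refl h = -[1+n]+1≡-n h

  emptyRules-sound : ∀ b {r} → r ∈ emptyRules b → r ≡ (⌜ start ⌝ , []) × b ≡ + 0
  emptyRules-sound (+ zero) (here refl) = refl , refl

  rule-sound : ∀ {N β w} → (N , β) ∈ rules → Sat I β w → I N w
  rule-sound (here refl)         (_ , v , refl , refl , s) = leading v , form-sound (+ 1) s
  rule-sound (there (here refl)) refl                      = subst (λ P → P []) (sym (I-from {a} ℕ.≤-refl)) refl
  rule-sound (there (there r)) s with ∈-++⁻ downRules r
  ... | inj₁ r∈ with ∈-cartesianProductWith⁻ downRule signs bits r∈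
  ...   | σ , c , _ , _ , refl with s
  ...     | _ , v , refl , refl , sv = subst (λ P → P (c ∷ v)) (sym (I-down σ)) (downRhs-sound σ c sv)
  rule-sound (there (there r)) s | inj₂ r∈ with ∈-++⁻ fromRules r∈
  ... | inj₁ r∈′ with ∈-cartesianProductWith⁻ fromRule small bits r∈′
  ...   | x , c , x∈ , _ , refl with s
  ...     | _ , v , refl , refl , sv =
    subst (λ P → P (c ∷ v)) (sym (I-from {x} (small⇒∣∣≤ x∈))) (form-sound (step x c) sv)
  rule-sound (there (there r)) s | inj₂ r∈ | inj₂ r∈′ with emptyRules-sound a r∈′ | s
  ... | refl , a≡0 | refl = empty , sym a≡0

  canonical×val⇔generates : ∀ w → (Canonical w × val w ≡ a) ⇔ Generates grammar w
  canonical×val⇔generates w = mk⇔ generate recognise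
    where
    generate : Canonical w × val w ≡ a → Generates grammar w
    generate (empty     , val≡a) = d-nt (emptyRule∈ (sym val≡a)) d-nil d-nil
    generate (leading u , val≡a) = derives-rule₁ grammar startRule∈ (d-term (form-complete u (+ 1) val≡a))
    recognise : Generates grammar w → Canonical w × val w ≡ a
    recognise g = Sat-[-]⁻ I (⟪ start ⟫) (derives-sound grammar I rule-sound g)

witness : ℤ → Word Bit
witness (+ m)    = ones m
witness -[1+ m ] = ones (suc m) ++ [ b0 ]

val-witness : ∀ x → val (witness x) ≡ x
val-witness (+ m)    = valFrom-ones (+ 0) m
val-witness -[1+ m ] = trans (valFrom-++ (+ 0) (ones (suc m)) [ b0 ]) (cong -_ (valFrom-ones (+ 0) (suc m)))

L-not-regular : ∀ a → ¬ IsRegular (L a)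
L-not-regular a = ¬regular-by-fooling-set prefix suffix accept reject
  where
  open ≡-Reasoning
  prefix suffix : ℕ → Word Bit
  prefix i = witness -[1+ i ]
  suffix j = ones (suc j) ++ witness a

  val-prefix++suffix : ∀ i j → val (prefix i ++ suffix j) ≡ valFrom -[1+ i ] (suffix j)
  val-prefix++suffix i j = trans (valFrom-++ (+ 0) (prefix i) (suffix j))
                                 (cong (λ x → valFrom x (suffix j)) (val-witness -[1+ i ]))

  suffix-leads-to-a : ∀ j → valFrom -[1+ j ] (suffix j) ≡ a
  suffix-leads-to-a j = begin
    valFrom -[1+ j ] (ones (suc j) ++ w)           ≡⟨ valFrom-++ -[1+ j ] (ones (suc j)) w ⟩
    valFrom (valFrom -[1+ j ] (ones (suc j))) w    ≡⟨ cong (λ x → valFrom x w) (valFrom-ones -[1+ j ] (suc j)) ⟩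
    valFrom (-[1+ j ] + + suc j) w                 ≡⟨ cong (λ x → valFrom x w) (ℤ.+-inverseˡ (+ suc j)) ⟩
    val w                                          ≡⟨ val-witness a ⟩
    a                                              ∎
    where w = witness a

  accept : ∀ i → L a (prefix i ++ suffix i)
  accept i = Equivalence.from (L⇔canonical×val a _)
               (leading _ , trans (val-prefix++suffix i i) (suffix-leads-to-a i))

  reject : ∀ {i j} → L a (prefix i ++ suffix j) → i ≡ j
  reject {i} {j} l = ℤ.-[1+-injective (valFrom-injective (suffix j) (begin
    valFrom -[1+ i ] (suffix j)    ≡⟨ sym (val-prefix++suffix i j) ⟩
    val (prefix i ++ suffix j)     ≡⟨ proj₂ (Equivalence.to (L⇔canonical×val a _) l) ⟩
    a                              ≡⟨ sym (suffix-leads-to-a j) ⟩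
    valFrom -[1+ j ] (suffix j)    ∎))

theorem2 : (a : ℤ) → IsContextFree (L a) × ¬ IsRegular (L a)
theorem2 a = (grammar , L⇔generates) , L-not-regular a
  where
  open Grammar a
  L⇔generates : ∀ w → L a w ⇔ Generates grammar w
  L⇔generates w = ⇔-trans (L⇔canonical×val a w) (canonical×val⇔generates w)
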